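{- Consider two PFCT-S instances with the same sources $[n]$, the same supplies $a_1,\dots,a_n$ and the same costs $f_1\ge f_2\ge\cdots\ge f_n$. The first has $m$ sinks with demands $b_1\ge\cdots\ge b_m$ and the second has $m'$ sinks with demands $b'_1\ge\cdots\ge b'_{m'}$. For $t\in(0,a([n])]$ let $\pi(t)$ be the smallest $j$ with $b([j])\ge t$ and $\pi'(t)$ the smallest $j$ with $b'([j])\ge t$. Suppose there is an integer $\Delta\ge0$ with $\pi'(t)\le\pi(t)+\Delta$ for every $t\in(0,a([n])]$. Then the cost of the greedy solution of the second instance is at most the optimum cost of the first instance plus $\Delta f_1+\sum_{i=2}^n f_i$.
   Context: A PFCT-S instance has sources $[n]$ with supplies $a_i\in\mathbb{Z}_{>0}$ and costs $f_i\ge0$, sinks with demands in $\mathbb{Z}_{>0}$, total supply equal to total demand; a solution is $x\ge0$ with row sums equal to supplies and column sums equal to demands, of cost $\sum_{i,j}\mathbf{1}_{x_{ij}>0}f_i$. For index sets $U$, $a(U)=\sum_{i\in U}a_i$, $b(U)=\sum_{j\in U}b_j$. With sources sorted by nonincreasing $f_i$ and sinks sorted by nonincreasing demand, the greedy solution is produced by: start with $x=0$, residual supplies and demands equal to the given ones, and $i=j=1$; while both indices are in range: set $x_{ij}$ to the minimum of the residual supply of $i$ and residual demand of $j$, subtract it from both, then increment $i$ if its residual supply is $0$, and increment $j$ if its residual demand is $0$.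
   Formalization: The costs $f_i$ and the entries of the solutions of the first instance are rational. -}

module Defs where

open import Data.Nat as ℕ using (ℕ; zero; suc; _∸_; _<ᵇ_; _≤ᵇ_)
import Data.Nat.Properties as ℕP
open import Data.Integer using (+_)
open import Data.Rational as ℚ using (ℚ; 0ℚ; _/_)
open import Data.Rational.Properties using (_<?_)
open import Data.Fin using (Fin; zero; suc; toℕ)
open import Data.List using (List; []; _∷_)
import Data.List as L
open import Data.Product using (_×_; _,_)
open import Data.Bool using (Bool; true; false; if_then_else_; _∧_)
open import Relation.Nullary using (does)
open import Data.Nat.ListAction using (sum)

ℕ→ℚ : ℕ → ℚ
ℕ→ℚ k = (+ k) / 1

Σℕ : ∀ {n} → (Fin n → ℕ) → ℕ
Σℕ {zero}  g = 0
Σℕ {suc n} g = g zero ℕ.+ Σℕ (λ i → g (suc i))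

Σℚ : ∀ {n} → (Fin n → ℚ) → ℚ
Σℚ {zero}  g = 0ℚ
Σℚ {suc n} g = g zero ℚ.+ Σℚ (λ i → g (suc i))

NonincreasingQ : ∀ {n} → (Fin n → ℚ) → Set
NonincreasingQ {n} f = ∀ (i j : Fin n) → toℕ i ℕ.≤ toℕ j → f j ℚ.≤ f i

NonincreasingN : ∀ {n} → (Fin n → ℕ) → Set
NonincreasingN {n} f = ∀ (i j : Fin n) → toℕ i ℕ.≤ toℕ j → f j ℕ.≤ f i

IsSolution : ∀ {n m} → (Fin n → ℕ) → (Fin m → ℕ) → (Fin n → Fin m → ℚ) → Set
IsSolution {n} {m} a b x =
  (∀ i j → 0ℚ ℚ.≤ x i j)
  × (∀ i → Σℚ (λ j → x i j) ≡ ℕ→ℚ (a i))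
  × (∀ j → Σℚ (λ i → x i j) ≡ ℕ→ℚ (b j))
  where open import Relation.Binary.PropositionalEquality using (_≡_)

costℚ : ∀ {n m} → (Fin n → ℚ) → (Fin n → Fin m → ℚ) → ℚ
costℚ f x = Σℚ (λ i → Σℚ (λ j → if does (0ℚ <? x i j) then f i else 0ℚ))

costℕ : ∀ {n m} → (Fin n → ℚ) → (Fin n → Fin m → ℕ) → ℚ
costℕ f x = Σℚ (λ i → Σℚ (λ j → if 0 <ᵇ x i j then f i else 0ℚ))

-- The greedy procedure.  'greedySteps fuel i j rs rd' runs the loop with current
-- (0-based) indices i, j, where rs = residual supplies of sources i, i+1, ...
-- and rd = residual demands of sinks j, j+1, ...; the loop stops when either
-- index runs out of range (list empty).  Since every iteration
-- increments i or j, fuel = n + m suffices for the loop to terminate.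
greedySteps : ℕ → ℕ → ℕ → List ℕ → List ℕ → List (ℕ × ℕ × ℕ)
greedySteps zero     i j rs       rd       = []
greedySteps (suc fu) i j []       rd       = []
greedySteps (suc fu) i j (s ∷ rs) []       = []
greedySteps (suc fu) i j (s ∷ rs) (d ∷ rd) =
  (i , j , ℕ._⊓_ s d) ∷ next (s ∸ ℕ._⊓_ s d) (d ∸ ℕ._⊓_ s d)
  where
  next : ℕ → ℕ → List (ℕ × ℕ × ℕ)
  next zero    zero    = greedySteps fu (suc i) (suc j) rs rd
  next zero    (suc d') = greedySteps fu (suc i) j rs (suc d' ∷ rd)
  next (suc s') zero    = greedySteps fu i (suc j) (suc s' ∷ rs) rd
  next (suc s') (suc d') = greedySteps fu i j (suc s' ∷ rs) (suc d' ∷ rd)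

toList : ∀ {n} → (Fin n → ℕ) → List ℕ
toList {n} g = L.tabulate {n = n} g

-- The greedy solution x (sources and sinks taken in the given order,
-- which the theorem assumes to be sorted): x_ij is the amount assigned
-- at the step visiting (i, j) (each pair is visited at most once), else 0.
greedy : ∀ {n m} → (Fin n → ℕ) → (Fin m → ℕ) → Fin n → Fin m → ℕ
greedy {n} {m} a b i j =
  sum (L.map amount (greedySteps (n ℕ.+ m) 0 0 (toList a) (toList b)))
  where
  amount : ℕ × ℕ × ℕ → ℕ
  amount (i' , j' , v) = if (toℕ i ℕ.≡ᵇ i') ∧ (toℕ j ℕ.≡ᵇ j') then v else 0

-- π b t = smallest j (1-based) with b_1 + ... + b_j ≥ t  (for 1 ≤ t ≤ b([m])).
-- Computed on the list of demands: if t ≤ b_1 the answer is 1, else 1 + π of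
-- the remaining demands at t - b_1.  (Returns 0 on the empty list, which is
-- never reached for t in range.)
πL : List ℕ → ℕ → ℕ
πL []       t = 0
πL (d ∷ ds) t = if t ≤ᵇ d then 1 else suc (πL ds (t ∸ d))

π : ∀ {m} → (Fin m → ℕ) → ℕ → ℕ
π b t = πL (toList b) t

{-# OPTIONS --safe #-}
-- Both costs are Σᵢ fᵢ·deg(i), where deg(i) counts the sinks served by source i.  Every
-- greedy step exhausts a source or a sink, so while the first k+1 sources are served the
-- greedy run visits at most π′(a([k+1])) sinks and hence makes at most π′(a([k+1])) + k
-- steps.  In any solution x the sinks reached by the first k+1 sources absorb their supply
-- a([k+1]); as b is sorted there are at least π(a([k+1])) of them.  With π′ ≤ π + Δ, the
-- greedy degrees are therefore prefix-dominated by deg_x + (Δ, 1, …, 1), and for weights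
-- f that are nonnegative and nonincreasing, prefix domination implies the corresponding
-- inequality of f-weighted sums.
module Submission where

open import Defs
open import Data.Nat using (ℕ; zero; suc; _≤_; _<_; _+_)
open import Data.Rational using (ℚ; 0ℚ)
open import Data.Rational as Q using ()
open import Data.Fin using (Fin; zero; suc)
open import Relation.Binary.PropositionalEquality using (_≡_)

open import Algebra.Bundles using (CommutativeMonoid)
import Algebra.Properties.CommutativeSemigroup as CommSemigroupProperties
open import Data.Bool using (Bool; true; false; if_then_else_; _∧_; _∨_)
open import Data.Fin using (toℕ)
import Data.Integer as ℤ
import Data.Integer.Properties as ℤP
open import Data.List using (List; []; _∷_; take; map)
open import Data.List.Relation.Unary.All using (All; []; _∷_)
open import Data.List.Relation.Unary.All.Properties using (tabulate⁺)
open import Data.Nat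
  using (_∸_; _⊓_; _<ᵇ_; _≤ᵇ_; _≡ᵇ_; z≤n; s≤s; Ordering; compare; less; equal; greater)
import Data.Nat.Properties as ℕP
open import Data.Nat.Coprimality using (1-coprimeTo) renaming (sym to coprime-sym)
open import Data.Nat.ListAction using (sum)
open import Data.Product using (_×_; _,_)
open import Data.Rational using (mkℚ)
import Data.Rational.Properties as QP
open import Data.Rational.Properties using (_<?_)
open import Function using (_∘_)
open import Relation.Binary.PropositionalEquality
  using (refl; sym; trans; cong; cong₂; subst; subst₂)
open import Relation.Nullary using (does; contradiction; ofⁿ)
open import Relation.Nullary.Decidable using (dec-true)

private
  module ℕ+ = CommSemigroupProperties ℕP.+-commutativeSemigroup
  module ℚ+ =
    CommSemigroupProperties (CommutativeMonoid.commutativeSemigroup QP.+-0-commutativeMonoid)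

ℕ→ℚ≡mkℚ : ∀ k → ℕ→ℚ k ≡ mkℚ (ℤ.+ k) 0 (coprime-sym (1-coprimeTo k))
ℕ→ℚ≡mkℚ k = QP.normalize-coprime (coprime-sym (1-coprimeTo k))

ℕ→ℚ-homo-+ : ∀ m n → ℕ→ℚ (m + n) ≡ ℕ→ℚ m Q.+ ℕ→ℚ n
ℕ→ℚ-homo-+ m n rewrite ℕ→ℚ≡mkℚ m | ℕ→ℚ≡mkℚ n =
  cong (Q._/ 1) (sym (cong₂ ℤ._+_ (ℤP.*-identityʳ (ℤ.+ m)) (ℤP.*-identityʳ (ℤ.+ n))))

ℕ→ℚ-mono-≤ : ∀ {m n} → m ≤ n → ℕ→ℚ m Q.≤ ℕ→ℚ n
ℕ→ℚ-mono-≤ {m} {n} m≤n rewrite ℕ→ℚ≡mkℚ m | ℕ→ℚ≡mkℚ n =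
  Q.*≤* (ℤP.*-monoʳ-≤-nonNeg (ℤ.+ 1) (ℤ.+≤+ m≤n))

ℕ→ℚ-cancel-≤ : ∀ {m n} → ℕ→ℚ m Q.≤ ℕ→ℚ n → m ≤ n
ℕ→ℚ-cancel-≤ {m} {n} le rewrite ℕ→ℚ≡mkℚ m | ℕ→ℚ≡mkℚ n with le
... | Q.*≤* m*1≤n*1 =
  ℤP.drop‿+≤+ (subst₂ ℤ._≤_ (ℤP.*-identityʳ (ℤ.+ m)) (ℤP.*-identityʳ (ℤ.+ n)) m*1≤n*1)

*-ℕ→ℚ-distrib-+ : ∀ q m n → q Q.* ℕ→ℚ (m + n) ≡ q Q.* ℕ→ℚ m Q.+ q Q.* ℕ→ℚ n
*-ℕ→ℚ-distrib-+ q m n = trans (cong (q Q.*_) (ℕ→ℚ-homo-+ m n)) (QP.*-distribˡ-+ q _ _)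

*-ℕ→ℚ-monoˡ-≤ : ∀ k {p q} → p Q.≤ q → p Q.* ℕ→ℚ k Q.≤ q Q.* ℕ→ℚ k
*-ℕ→ℚ-monoˡ-≤ k =
  QP.*-monoʳ-≤-nonNeg (ℕ→ℚ k) {{Q.nonNegative {ℕ→ℚ k} (ℕ→ℚ-mono-≤ {0} {k} z≤n)}}

Σℕ-cong : ∀ {n} {g h : Fin n → ℕ} → (∀ i → g i ≡ h i) → Σℕ g ≡ Σℕ h
Σℕ-cong {zero}  _   = refl
Σℕ-cong {suc n} g≗h = cong₂ _+_ (g≗h zero) (Σℕ-cong (g≗h ∘ suc))

Σℕ-mono-≤ : ∀ {n} {g h : Fin n → ℕ} → (∀ i → g i ≤ h i) → Σℕ g ≤ Σℕ h
Σℕ-mono-≤ {zero}  _   = z≤n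
Σℕ-mono-≤ {suc n} g≤h = ℕP.+-mono-≤ (g≤h zero) (Σℕ-mono-≤ (g≤h ∘ suc))

Σℕ-zero : ∀ n → Σℕ {n} (λ _ → 0) ≡ 0
Σℕ-zero zero    = refl
Σℕ-zero (suc n) = Σℕ-zero n

Σℕ-distrib-+ : ∀ {n} (g h : Fin n → ℕ) → Σℕ (λ i → g i + h i) ≡ Σℕ g + Σℕ h
Σℕ-distrib-+ {zero}  _ _ = refl
Σℕ-distrib-+ {suc n} g h =
  trans (cong ((g zero + h zero) +_) (Σℕ-distrib-+ (g ∘ suc) (h ∘ suc)))
        (ℕ+.interchange (g zero) (h zero) (Σℕ (g ∘ suc)) (Σℕ (h ∘ suc)))

Σℕ-comm : ∀ {n m} (g : Fin n → Fin m → ℕ) → Σℕ (λ i → Σℕ (g i)) ≡ Σℕ (λ j → Σℕ (λ i → g i j))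
Σℕ-comm {zero}  {m} _ = sym (Σℕ-zero m)
Σℕ-comm {suc n}     g =
  trans (cong (Σℕ (g zero) +_) (Σℕ-comm (g ∘ suc))) (sym (Σℕ-distrib-+ (g zero) _))

Σℚ-cong : ∀ {n} {g h : Fin n → ℚ} → (∀ i → g i ≡ h i) → Σℚ g ≡ Σℚ h
Σℚ-cong {zero}  _   = refl
Σℚ-cong {suc n} g≗h = cong₂ Q._+_ (g≗h zero) (Σℚ-cong (g≗h ∘ suc))

Σℚ-mono-≤ : ∀ {n} {g h : Fin n → ℚ} → (∀ i → g i Q.≤ h i) → Σℚ g Q.≤ Σℚ h
Σℚ-mono-≤ {zero}  _   = QP.≤-refl
Σℚ-mono-≤ {suc n} g≤h = QP.+-mono-≤ (g≤h zero) (Σℚ-mono-≤ (g≤h ∘ suc))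

Σℚ-zero : ∀ n → Σℚ {n} (λ _ → 0ℚ) ≡ 0ℚ
Σℚ-zero zero    = refl
Σℚ-zero (suc n) = trans (QP.+-identityˡ _) (Σℚ-zero n)

Σℚ-distrib-+ : ∀ {n} (g h : Fin n → ℚ) → Σℚ (λ i → g i Q.+ h i) ≡ Σℚ g Q.+ Σℚ h
Σℚ-distrib-+ {zero}  _ _ = refl
Σℚ-distrib-+ {suc n} g h =
  trans (cong ((g zero Q.+ h zero) Q.+_) (Σℚ-distrib-+ (g ∘ suc) (h ∘ suc)))
        (ℚ+.interchange (g zero) (h zero) (Σℚ (g ∘ suc)) (Σℚ (h ∘ suc)))

Σℚ-comm : ∀ {n m} (g : Fin n → Fin m → ℚ) → Σℚ (λ i → Σℚ (g i)) ≡ Σℚ (λ j → Σℚ (λ i → g i j))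
Σℚ-comm {zero}  {m} _ = sym (Σℚ-zero m)
Σℚ-comm {suc n}     g =
  trans (cong (Σℚ (g zero) Q.+_) (Σℚ-comm (g ∘ suc))) (sym (Σℚ-distrib-+ (g zero) _))

ℕ→ℚ-Σ : ∀ {n} (g : Fin n → ℕ) → ℕ→ℚ (Σℕ g) ≡ Σℚ (ℕ→ℚ ∘ g)
ℕ→ℚ-Σ {zero}  _ = refl
ℕ→ℚ-Σ {suc n} g =
  trans (ℕ→ℚ-homo-+ (g zero) _) (cong (ℕ→ℚ (g zero) Q.+_) (ℕ→ℚ-Σ (g ∘ suc)))

indicator : Bool → ℕ
indicator b = if b then 1 else 0

count : ∀ {n} → (Fin n → Bool) → ℕ
count p = Σℕ (indicator ∘ p)

sumOver : ∀ {n} → (Fin n → Bool) → (Fin n → ℕ) → ℕ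
sumOver r u = Σℕ (λ i → if r i then u i else 0)

sumOver-cong : ∀ {n} (r : Fin n → Bool) {u v : Fin n → ℕ} →
  (∀ i → u i ≡ v i) → sumOver r u ≡ sumOver r v
sumOver-cong r u≗v = Σℕ-cong (λ i → cong (λ z → if r i then z else 0) (u≗v i))

sumOver-mono-≤ : ∀ {n} (r : Fin n → Bool) {u v : Fin n → ℕ} →
  (∀ i → u i ≤ v i) → sumOver r u ≤ sumOver r v
sumOver-mono-≤ r u≤v = Σℕ-mono-≤ pointwise
  where
  pointwise : ∀ i → (if r i then _ else 0) ≤ (if r i then _ else 0)
  pointwise i with r i
  ... | true  = u≤v i
  ... | false = z≤n

sumOver≤Σℕ : ∀ {n} (r : Fin n → Bool) (u : Fin n → ℕ) → sumOver r u ≤ Σℕ u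
sumOver≤Σℕ r u = Σℕ-mono-≤ pointwise
  where
  pointwise : ∀ i → (if r i then u i else 0) ≤ u i
  pointwise i with r i
  ... | true  = ℕP.≤-refl
  ... | false = z≤n

sumOver-distrib-+ : ∀ {n} (r : Fin n → Bool) (u v : Fin n → ℕ) →
  sumOver r (λ i → u i + v i) ≡ sumOver r u + sumOver r v
sumOver-distrib-+ r u v =
  trans (Σℕ-cong pointwise) (Σℕ-distrib-+ (λ i → if r i then u i else 0) (λ i → if r i then v i else 0))
  where
  pointwise : ∀ i →
    (if r i then u i + v i else 0) ≡ (if r i then u i else 0) + (if r i then v i else 0)
  pointwise i with r i
  ... | true  = refl
  ... | false = refl

prefixSum : ∀ {n} → ℕ → (Fin n → ℕ) → ℕ
prefixSum k = sumOver (λ i → toℕ i <ᵇ k)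

prefixSum-zero : ∀ {n} (u : Fin n → ℕ) → prefixSum 0 u ≡ 0
prefixSum-zero {n} _ = Σℕ-zero n

prefixSum-one : ∀ {n} (u : Fin (suc n) → ℕ) → prefixSum 1 u ≡ u zero
prefixSum-one u = trans (cong (u zero +_) (prefixSum-zero (u ∘ suc))) (ℕP.+-identityʳ (u zero))

prefixSum-const-1 : ∀ {n} k → k ≤ n → prefixSum {n} k (λ _ → 1) ≡ k
prefixSum-const-1 {n} zero _         = Σℕ-zero n
prefixSum-const-1     (suc k) (s≤s k≤n) = cong suc (prefixSum-const-1 k k≤n)

prefixSum≡sum∘take : ∀ {n} k (u : Fin n → ℕ) → prefixSum k u ≡ sum (take k (toList u))
prefixSum≡sum∘take         zero    u = prefixSum-zero u
prefixSum≡sum∘take {zero}  (suc k) u = refl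
prefixSum≡sum∘take {suc n} (suc k) u = cong (u zero +_) (prefixSum≡sum∘take k (u ∘ suc))

weightedSum : ∀ {n} → (Fin n → ℚ) → (Fin n → ℕ) → ℚ
weightedSum f u = Σℚ (λ i → f i Q.* ℕ→ℚ (u i))

weightedSum-distrib-+ : ∀ {n} (f : Fin n → ℚ) (u v : Fin n → ℕ) →
  weightedSum f (λ i → u i + v i) ≡ weightedSum f u Q.+ weightedSum f v
weightedSum-distrib-+ f u v =
  trans (Σℚ-cong (λ i → *-ℕ→ℚ-distrib-+ (f i) (u i) (v i)))
        (Σℚ-distrib-+ (λ i → f i Q.* ℕ→ℚ (u i)) (λ i → f i Q.* ℕ→ℚ (v i)))

nonincreasingQ-tail : ∀ {n} {f : Fin (suc n) → ℚ} → NonincreasingQ f → NonincreasingQ (f ∘ suc)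
nonincreasingQ-tail f↓ i j i≤j = f↓ (suc i) (suc j) (s≤s i≤j)

PrefixDominated : ∀ {n} → ℕ → (Fin n → ℕ) → (Fin n → ℕ) → Set
PrefixDominated {n} s u v = ∀ k → k ≤ n → prefixSum k u ≤ s + prefixSum k v

prefixDominated-head : ∀ {n s} (u v : Fin (suc n) → ℕ) →
  PrefixDominated s u v → u zero ≤ s + v zero
prefixDominated-head {s = s} u v u≼v =
  subst₂ _≤_ (prefixSum-one u) (cong (s +_) (prefixSum-one v)) (u≼v 1 (s≤s z≤n))

prefixDominated-tail : ∀ {n s} (u v : Fin (suc n) → ℕ) → PrefixDominated s u v →
  PrefixDominated (s + v zero ∸ u zero) (u ∘ suc) (v ∘ suc)
prefixDominated-tail {s = s} u v u≼v k k≤n = ℕP.+-cancelˡ-≤ u₀ _ _ (begin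
  u₀ + prefixSum k (u ∘ suc)          ≤⟨ u≼v (suc k) (s≤s k≤n) ⟩
  s + (v₀ + prefixSum k (v ∘ suc))    ≡⟨ ℕP.+-assoc s v₀ _ ⟨
  s + v₀ + prefixSum k (v ∘ suc)      ≡⟨ cong (_+ prefixSum k (v ∘ suc)) u₀+s′≡s+v₀ ⟨
  u₀ + s′ + prefixSum k (v ∘ suc)     ≡⟨ ℕP.+-assoc u₀ s′ _ ⟩
  u₀ + (s′ + prefixSum k (v ∘ suc))   ∎)
  where
  open ℕP.≤-Reasoning
  u₀ = u zero
  v₀ = v zero
  s′ = s + v₀ ∸ u₀
  u₀+s′≡s+v₀ : u₀ + s′ ≡ s + v₀
  u₀+s′≡s+v₀ = ℕP.m+[n∸m]≡n (prefixDominated-head u v u≼v)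

-- The slack s is what makes the induction go through: the tail of u is dominated by the
-- tail of v only up to the surplus s + v₀ ∸ u₀, which is paid for at a weight ≤ F.
weightedSum-mono-slack : ∀ {n} {f : Fin n → ℚ} (u v : Fin n → ℕ) (F : ℚ) (s : ℕ) →
  0ℚ Q.≤ F → (∀ i → f i Q.≤ F) → (∀ i → 0ℚ Q.≤ f i) → NonincreasingQ f →
  PrefixDominated s u v → weightedSum f u Q.≤ F Q.* ℕ→ℚ s Q.+ weightedSum f v
weightedSum-mono-slack {zero} _ _ F s 0≤F _ _ _ _ = begin
  0ℚ                     ≡⟨ QP.*-zeroˡ (ℕ→ℚ s) ⟨
  0ℚ Q.* ℕ→ℚ s           ≤⟨ *-ℕ→ℚ-monoˡ-≤ s 0≤F ⟩
  F Q.* ℕ→ℚ s            ≡⟨ QP.+-identityʳ _ ⟨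
  F Q.* ℕ→ℚ s Q.+ 0ℚ     ∎
  where open QP.≤-Reasoning
weightedSum-mono-slack {suc n} {f} u v F s 0≤F f≤F 0≤f f↓ u≼v = begin
  f₀ Q.* ⟦ u₀ ⟧ Q.+ W′ u
    ≤⟨ QP.+-monoʳ-≤ (f₀ Q.* ⟦ u₀ ⟧) tail≤ ⟩
  f₀ Q.* ⟦ u₀ ⟧ Q.+ (f₀ Q.* ⟦ s′ ⟧ Q.+ W′ v)
    ≡⟨ QP.+-assoc (f₀ Q.* ⟦ u₀ ⟧) (f₀ Q.* ⟦ s′ ⟧) (W′ v) ⟨
  f₀ Q.* ⟦ u₀ ⟧ Q.+ f₀ Q.* ⟦ s′ ⟧ Q.+ W′ v
    ≡⟨ cong (Q._+ W′ v) (*-ℕ→ℚ-distrib-+ f₀ u₀ s′) ⟨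
  f₀ Q.* ⟦ u₀ + s′ ⟧ Q.+ W′ v
    ≡⟨ cong (λ z → f₀ Q.* ⟦ z ⟧ Q.+ W′ v) (ℕP.m+[n∸m]≡n (prefixDominated-head u v u≼v)) ⟩
  f₀ Q.* ⟦ s + v₀ ⟧ Q.+ W′ v
    ≡⟨ cong (Q._+ W′ v) (*-ℕ→ℚ-distrib-+ f₀ s v₀) ⟩
  f₀ Q.* ⟦ s ⟧ Q.+ f₀ Q.* ⟦ v₀ ⟧ Q.+ W′ v
    ≤⟨ QP.+-monoˡ-≤ (W′ v) (QP.+-monoˡ-≤ (f₀ Q.* ⟦ v₀ ⟧) (*-ℕ→ℚ-monoˡ-≤ s (f≤F zero))) ⟩
  F Q.* ⟦ s ⟧ Q.+ f₀ Q.* ⟦ v₀ ⟧ Q.+ W′ v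
    ≡⟨ QP.+-assoc (F Q.* ⟦ s ⟧) (f₀ Q.* ⟦ v₀ ⟧) (W′ v) ⟩
  F Q.* ⟦ s ⟧ Q.+ (f₀ Q.* ⟦ v₀ ⟧ Q.+ W′ v) ∎
  where
  open QP.≤-Reasoning
  ⟦_⟧ : ℕ → ℚ
  ⟦_⟧ = ℕ→ℚ
  f₀ = f zero
  u₀ = u zero
  v₀ = v zero
  s′ = s + v₀ ∸ u₀
  W′ : (Fin (suc n) → ℕ) → ℚ
  W′ w = weightedSum (f ∘ suc) (w ∘ suc)
  tail≤ : W′ u Q.≤ f₀ Q.* ⟦ s′ ⟧ Q.+ W′ v
  tail≤ = weightedSum-mono-slack (u ∘ suc) (v ∘ suc) f₀ s′ (0≤f zero) (λ i → f↓ zero (suc i) z≤n)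
                                 (0≤f ∘ suc) (nonincreasingQ-tail f↓) (prefixDominated-tail u v u≼v)

weightedSum-mono-prefix : ∀ {n} {f : Fin n → ℚ} (u v : Fin n → ℕ) →
  (∀ i → 0ℚ Q.≤ f i) → NonincreasingQ f → PrefixDominated 0 u v →
  weightedSum f u Q.≤ weightedSum f v
weightedSum-mono-prefix {zero} _ _ _ _ _ = QP.≤-refl
weightedSum-mono-prefix {suc n} {f} u v 0≤f f↓ u≼v =
  QP.≤-trans (weightedSum-mono-slack u v (f zero) 0 (0≤f zero) (λ i → f↓ zero i z≤n) 0≤f f↓ u≼v)
             (QP.≤-reflexive (trans (cong (Q._+ weightedSum f v) (QP.*-zeroʳ (f zero)))
                                    (QP.+-identityˡ (weightedSum f v))))

degreeℚ : ∀ {n m} → (Fin n → Fin m → ℚ) → Fin n → ℕ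
degreeℚ x i = count (λ j → does (0ℚ <? x i j))

degreeℕ : ∀ {n m} → (Fin n → Fin m → ℕ) → Fin n → ℕ
degreeℕ x i = count (λ j → 0 <ᵇ x i j)

Σℚ-if≡*count : ∀ {m} (c : Fin m → Bool) (q : ℚ) →
  Σℚ (λ j → if c j then q else 0ℚ) ≡ q Q.* ℕ→ℚ (count c)
Σℚ-if≡*count {zero}  _ q = sym (QP.*-zeroʳ q)
Σℚ-if≡*count {suc m} c q =
  trans (cong₂ Q._+_ (head (c zero)) (Σℚ-if≡*count (c ∘ suc) q))
        (sym (*-ℕ→ℚ-distrib-+ q (indicator (c zero)) (count (c ∘ suc))))
  where
  head : ∀ b → (if b then q else 0ℚ) ≡ q Q.* ℕ→ℚ (indicator b)
  head true  = sym (QP.*-identityʳ q)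
  head false = sym (QP.*-zeroʳ q)

costℚ≡weightedSum-degree : ∀ {n m} (f : Fin n → ℚ) (x : Fin n → Fin m → ℚ) →
  costℚ f x ≡ weightedSum f (degreeℚ x)
costℚ≡weightedSum-degree f x =
  Σℚ-cong (λ i → Σℚ-if≡*count (λ j → does (0ℚ <? x i j)) (f i))

costℕ≡weightedSum-degree : ∀ {n m} (f : Fin n → ℚ) (x : Fin n → Fin m → ℕ) →
  costℕ f x ≡ weightedSum f (degreeℕ x)
costℕ≡weightedSum-degree f x = Σℚ-cong (λ i → Σℚ-if≡*count (λ j → 0 <ᵇ x i j) (f i))

≤ᵇ-suc : ∀ m n → (suc m ≤ᵇ suc n) ≡ (m ≤ᵇ n)
≤ᵇ-suc zero    n = refl
≤ᵇ-suc (suc m) n = refl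

πL-shift : ∀ s d ds t → πL (s + d ∷ ds) (s + t) ≡ πL (d ∷ ds) t
πL-shift zero    d ds t = refl
πL-shift (suc s) d ds t =
  trans (cong (λ b → if b then 1 else suc (πL ds (s + t ∸ (s + d)))) (≤ᵇ-suc (s + t) (s + d)))
        (πL-shift s d ds t)

πL-skip : ∀ d ds t → πL (d ∷ ds) (d + suc t) ≡ suc (πL ds (suc t))
πL-skip d ds t = trans (cong (λ e → πL (e ∷ ds) (d + suc t)) (sym (ℕP.+-identityʳ d)))
                       (πL-shift d 0 ds (suc t))

πL-positive : ∀ d ds t → 1 ≤ πL (d ∷ ds) t
πL-positive d ds t with t ≤ᵇ d
... | true  = s≤s z≤n
... | false = s≤s z≤n

πL-≤ : ∀ ds s t → 1 ≤ t → t ≤ sum (take s ds) → πL ds t ≤ s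
πL-≤ []       s       t _   _   = z≤n
πL-≤ (d ∷ ds) zero    t 1≤t t≤0 = contradiction (ℕP.≤-trans 1≤t t≤0) λ ()
πL-≤ (d ∷ ds) (suc s) t 1≤t t≤d+ with t ≤ᵇ d | ℕP.≤ᵇ-reflects-≤ t d
... | true  | _        = s≤s z≤n
... | false | ofⁿ t≰d = s≤s (πL-≤ ds s (t ∸ d) (ℕP.m<n⇒0<n∸m (ℕP.≰⇒> t≰d))
  (ℕP.≤-trans (ℕP.∸-monoˡ-≤ d t≤d+) (ℕP.≤-reflexive (ℕP.m+n∸m≡n d _))))

π≤ : ∀ {m} (b : Fin m → ℕ) {s t} → 1 ≤ t → t ≤ prefixSum s b → π b t ≤ s
π≤ b {s} {t} 1≤t t≤b[s] = πL-≤ (toList b) s t 1≤t (subst (t ≤_) (prefixSum≡sum∘take s b) t≤b[s])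

nonincreasingN-tail : ∀ {n} {b : Fin (suc n) → ℕ} → NonincreasingN b → NonincreasingN (b ∘ suc)
nonincreasingN-tail b↓ i j i≤j = b↓ (suc i) (suc j) (s≤s i≤j)

prefixSum-tail≤ : ∀ {m} (b : Fin (suc m) → ℕ) k → NonincreasingN b →
  prefixSum k (b ∘ suc) ≤ prefixSum k b
prefixSum-tail≤         b zero    _  = ℕP.≤-refl
prefixSum-tail≤ {zero}  b (suc k) _  = z≤n
prefixSum-tail≤ {suc m} b (suc k) b↓ =
  ℕP.+-mono-≤ (b↓ zero (suc zero) z≤n) (prefixSum-tail≤ (b ∘ suc) k (nonincreasingN-tail b↓))

sumOver≤prefixSum-count : ∀ {m} (b : Fin m → ℕ) (y : Fin m → Bool) → NonincreasingN b →
  sumOver y b ≤ prefixSum (count y) b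
sumOver≤prefixSum-count {zero}  b y _  = z≤n
sumOver≤prefixSum-count {suc m} b y b↓ with y zero
... | true  = ℕP.+-monoʳ-≤ (b zero) tail≤
  where tail≤ = sumOver≤prefixSum-count (b ∘ suc) (y ∘ suc) (nonincreasingN-tail b↓)
... | false = ℕP.≤-trans tail≤ (prefixSum-tail≤ b (count (y ∘ suc)) b↓)
  where tail≤ = sumOver≤prefixSum-count (b ∘ suc) (y ∘ suc) (nonincreasingN-tail b↓)

anyᶠ : ∀ {n} → (Fin n → Bool) → Bool
anyᶠ {zero}  _ = false
anyᶠ {suc n} p = p zero ∨ anyᶠ (p ∘ suc)

anyᶠ-intro : ∀ {n} (p : Fin n → Bool) i → p i ≡ true → anyᶠ p ≡ true
anyᶠ-intro p zero    pi≡true rewrite pi≡true = refl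
anyᶠ-intro p (suc i) pi≡true with p zero
... | true  = refl
... | false = anyᶠ-intro (p ∘ suc) i pi≡true

indicator-anyᶠ≤count : ∀ {n} (p : Fin n → Bool) → indicator (anyᶠ p) ≤ count p
indicator-anyᶠ≤count {zero}  _ = z≤n
indicator-anyᶠ≤count {suc n} p with p zero
... | true  = s≤s z≤n
... | false = indicator-anyᶠ≤count (p ∘ suc)

touched : ∀ {n m} → (Fin n → Bool) → (Fin n → Fin m → ℚ) → Fin m → Bool
touched r x j = anyᶠ (λ i → r i ∧ does (0ℚ <? x i j))

count-touched≤sumOver-degree : ∀ {n m} (r : Fin n → Bool) (x : Fin n → Fin m → ℚ) →
  count (touched r x) ≤ sumOver r (degreeℚ x)
count-touched≤sumOver-degree {m = m} r x = begin
  count (touched r x)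
    ≤⟨ Σℕ-mono-≤ (λ j → indicator-anyᶠ≤count (λ i → r i ∧ positive i j)) ⟩
  Σℕ (λ j → Σℕ (λ i → indicator (r i ∧ positive i j)))
    ≡⟨ Σℕ-comm (λ i j → indicator (r i ∧ positive i j)) ⟨
  Σℕ (λ i → Σℕ (λ j → indicator (r i ∧ positive i j)))
    ≡⟨ Σℕ-cong (λ i → rowCount (r i) i) ⟩
  sumOver r (degreeℚ x) ∎
  where
  open ℕP.≤-Reasoning
  positive : _ → _ → Bool
  positive i j = does (0ℚ <? x i j)
  rowCount : ∀ c i → Σℕ (λ j → indicator (c ∧ positive i j)) ≡ (if c then degreeℚ x i else 0)
  rowCount true  i = refl
  rowCount false i = Σℕ-zero m

if-≤-if : (c y : Bool) (q : ℚ) → 0ℚ Q.≤ q → (c ≡ true → 0ℚ Q.< q → y ≡ true) →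
  (if c then q else 0ℚ) Q.≤ (if y then q else 0ℚ)
if-≤-if false true  q 0≤q _ = 0≤q
if-≤-if false false q _   _ = QP.≤-refl
if-≤-if true  true  q _   _ = QP.≤-refl
if-≤-if true  false q _   c⇒y = QP.≮⇒≥ (λ 0<q → contradiction (c⇒y refl 0<q) λ ())

supply≤touchedDemand : ∀ {n m} {a : Fin n → ℕ} {b : Fin m → ℕ} {x : Fin n → Fin m → ℚ}
  (r : Fin n → Bool) → IsSolution a b x → sumOver r a ≤ sumOver (touched r x) b
supply≤touchedDemand {n} {m} {a} {b} {x} r (x≥0 , rowSums , columnSums) = ℕ→ℚ-cancel-≤ (begin
  ℕ→ℚ (sumOver r a)                                ≡⟨ ℕ→ℚ-Σ (λ i → if r i then a i else 0) ⟩
  Σℚ (λ i → ℕ→ℚ (if r i then a i else 0))          ≡⟨ Σℚ-cong rows ⟩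
  Σℚ (λ i → Σℚ (λ j → if r i then x i j else 0ℚ))   ≤⟨ Σℚ-mono-≤ (λ i → Σℚ-mono-≤ (entry i)) ⟩
  Σℚ (λ i → Σℚ (λ j → if T j then x i j else 0ℚ))   ≡⟨ Σℚ-comm (λ i j → if T j then x i j else 0ℚ) ⟩
  Σℚ (λ j → Σℚ (λ i → if T j then x i j else 0ℚ))   ≡⟨ Σℚ-cong columns ⟩
  Σℚ (λ j → ℕ→ℚ (if T j then b j else 0))          ≡⟨ ℕ→ℚ-Σ (λ j → if T j then b j else 0) ⟨
  ℕ→ℚ (sumOver T b)                                ∎)
  where
  open QP.≤-Reasoning
  T = touched r x
  rows : ∀ i → ℕ→ℚ (if r i then a i else 0) ≡ Σℚ (λ j → if r i then x i j else 0ℚ)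
  rows i with r i
  ... | true  = sym (rowSums i)
  ... | false = sym (Σℚ-zero m)
  columns : ∀ j → Σℚ (λ i → if T j then x i j else 0ℚ) ≡ ℕ→ℚ (if T j then b j else 0)
  columns j with T j
  ... | true  = columnSums j
  ... | false = Σℚ-zero n
  entry : ∀ i j → (if r i then x i j else 0ℚ) Q.≤ (if T j then x i j else 0ℚ)
  entry i j = if-≤-if (r i) (T j) (x i j) (x≥0 i j) λ ri≡true 0<xij →
    anyᶠ-intro (λ i′ → r i′ ∧ does (0ℚ <? x i′ j)) i
               (cong₂ _∧_ ri≡true (dec-true (0ℚ <? x i j) 0<xij))

π-prefixSupply≤prefixDegree : ∀ {n m} {a : Fin n → ℕ} {b : Fin m → ℕ} {x : Fin n → Fin m → ℚ} K →
  IsSolution a b x → NonincreasingN b → 1 ≤ prefixSum K a →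
  π b (prefixSum K a) ≤ prefixSum K (degreeℚ x)
π-prefixSupply≤prefixDegree {b = b} {x} K sol b↓ 1≤A =
  ℕP.≤-trans (π≤ b 1≤A (ℕP.≤-trans (supply≤touchedDemand firstK sol)
                                   (sumOver≤prefixSum-count b (touched firstK x) b↓)))
             (count-touched≤sumOver-degree firstK x)
  where
  firstK : _ → Bool
  firstK i = toℕ i <ᵇ K

Step : Set
Step = ℕ × ℕ × ℕ

greedyNext : ∀ {s d} → Ordering s d → ℕ → ℕ → ℕ → List ℕ → List ℕ → List Step
greedyNext (equal _)     fu i j rs rd = greedySteps fu (suc i) (suc j) rs rd
greedyNext (less _ e)    fu i j rs rd = greedySteps fu (suc i) j rs (suc e ∷ rd)
greedyNext (greater _ e) fu i j rs rd = greedySteps fu i (suc j) (suc e ∷ rs) rd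

greedySteps-unfold : ∀ fu i j s d rs rd →
  greedySteps (suc fu) i j (s ∷ rs) (d ∷ rd)
    ≡ (i , j , s ⊓ d) ∷ greedyNext (compare s d) fu i j rs rd
greedySteps-unfold fu i j s d rs rd with compare s d
... | equal s rewrite ℕP.⊓-idem s | ℕP.n∸n≡0 s = refl
... | less s e
  rewrite ℕP.m≤n⇒m⊓n≡m (ℕP.m≤n⇒m≤1+n (ℕP.m≤m+n s e)) | ℕP.n∸n≡0 s
        | sym (ℕP.+-suc s e) | ℕP.m+n∸m≡n s (suc e) = refl
... | greater d e
  rewrite ℕP.m≥n⇒m⊓n≡n (ℕP.m≤n⇒m≤1+n (ℕP.m≤m+n d e)) | ℕP.n∸n≡0 d
        | sym (ℕP.+-suc d e) | ℕP.m+n∸m≡n d (suc e) = refl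

stepsBelow : ℕ → List Step → ℕ
stepsBelow K []                  = 0
stepsBelow K ((i , _ , _) ∷ ss) = indicator (i <ᵇ K) + stepsBelow K ss

<ᵇ-false : ∀ {i K} → K ≤ i → (i <ᵇ K) ≡ false
<ᵇ-false z≤n       = refl
<ᵇ-false (s≤s K≤i) = <ᵇ-false K≤i

<ᵇ-+suc : ∀ i k → (i <ᵇ i + suc k) ≡ true
<ᵇ-+suc zero    k = refl
<ᵇ-+suc (suc i) k = <ᵇ-+suc i k

greedySteps-[] : ∀ fu i j rd → greedySteps fu i j [] rd ≡ []
greedySteps-[] zero    i j rd = refl
greedySteps-[] (suc fu) i j rd = refl

stepsBelow-greedySteps-unfold : ∀ K fu i j s d rs rd →
  stepsBelow K (greedySteps (suc fu) i j (s ∷ rs) (d ∷ rd))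
    ≡ indicator (i <ᵇ K) + stepsBelow K (greedyNext (compare s d) fu i j rs rd)
stepsBelow-greedySteps-unfold K fu i j s d rs rd =
  cong (stepsBelow K) (greedySteps-unfold fu i j s d rs rd)

stepsBelow-greedySteps≡0 : ∀ fu i j rs rd {K} → K ≤ i →
  stepsBelow K (greedySteps fu i j rs rd) ≡ 0
stepsBelow-greedyNext≡0 : ∀ {s d} (o : Ordering s d) fu i j rs rd {K} → K ≤ i →
  stepsBelow K (greedyNext o fu i j rs rd) ≡ 0

stepsBelow-greedySteps≡0 zero     i j rs       rd       K≤i = refl
stepsBelow-greedySteps≡0 (suc fu) i j []       rd       K≤i = refl
stepsBelow-greedySteps≡0 (suc fu) i j (s ∷ rs) []       K≤i = refl
stepsBelow-greedySteps≡0 (suc fu) i j (s ∷ rs) (d ∷ rd) {K} K≤i =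
  trans (stepsBelow-greedySteps-unfold K fu i j s d rs rd)
        (cong₂ (λ b n → indicator b + n) (<ᵇ-false K≤i)
               (stepsBelow-greedyNext≡0 (compare s d) fu i j rs rd K≤i))

stepsBelow-greedyNext≡0 (equal _)     fu i j rs rd K≤i =
  stepsBelow-greedySteps≡0 fu (suc i) (suc j) rs rd (ℕP.m≤n⇒m≤1+n K≤i)
stepsBelow-greedyNext≡0 (less _ e)    fu i j rs rd K≤i =
  stepsBelow-greedySteps≡0 fu (suc i) j rs (suc e ∷ rd) (ℕP.m≤n⇒m≤1+n K≤i)
stepsBelow-greedyNext≡0 (greater _ e) fu i j rs rd K≤i =
  stepsBelow-greedySteps≡0 fu i (suc j) (suc e ∷ rs) rd K≤i

1≤πL+ : ∀ d ds t k → 1 ≤ πL (d ∷ ds) t + k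
1≤πL+ d ds t k = ℕP.≤-trans (πL-positive d ds t) (ℕP.m≤m+n _ k)

stepsBelow-greedySteps≤ : ∀ fu i j rs rd → All (0 <_) rs → ∀ k →
  stepsBelow (i + suc k) (greedySteps fu i j rs rd) ≤ πL rd (sum (take (suc k) rs)) + k
stepsBelow-greedyNext< : ∀ {s d} (o : Ordering s d) fu i j rs rd → All (0 <_) rs → ∀ k →
  stepsBelow (i + suc k) (greedyNext o fu i j rs rd) < πL (d ∷ rd) (s + sum (take k rs)) + k
stepsBelow-sourceUsedUp< : ∀ fu i j rs rd {d ds s} → All (0 <_) rs →
  (∀ t → 1 ≤ t → πL rd t ≤ πL (d ∷ ds) (s + t)) → ∀ k →
  stepsBelow (i + suc k) (greedySteps fu (suc i) j rs rd) < πL (d ∷ ds) (s + sum (take k rs)) + k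

stepsBelow-greedySteps≤ zero     i j rs       rd       _ k = z≤n
stepsBelow-greedySteps≤ (suc fu) i j []       rd       _ k = z≤n
stepsBelow-greedySteps≤ (suc fu) i j (s ∷ rs) []       _ k = z≤n
stepsBelow-greedySteps≤ (suc fu) i j (s ∷ rs) (d ∷ rd) (_ ∷ rs>0) k = begin
  stepsBelow (i + suc k) (greedySteps (suc fu) i j (s ∷ rs) (d ∷ rd))
    ≡⟨ stepsBelow-greedySteps-unfold (i + suc k) fu i j s d rs rd ⟩
  indicator (i <ᵇ i + suc k) + rest
    ≡⟨ cong (λ b → indicator b + rest) (<ᵇ-+suc i k) ⟩
  suc rest
    ≤⟨ stepsBelow-greedyNext< (compare s d) fu i j rs rd rs>0 k ⟩
  πL (d ∷ rd) (s + sum (take k rs)) + k ∎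
  where
  open ℕP.≤-Reasoning
  rest = stepsBelow (i + suc k) (greedyNext (compare s d) fu i j rs rd)

stepsBelow-greedyNext< (equal s) fu i j rs rd rs>0 =
  stepsBelow-sourceUsedUp< fu i (suc j) rs rd {s} {rd} {s} rs>0 πL≤
  where
  πL≤ : ∀ t → 1 ≤ t → πL rd t ≤ πL (s ∷ rd) (s + t)
  πL≤ (suc t) _ = ℕP.≤-trans (ℕP.n≤1+n _) (ℕP.≤-reflexive (sym (πL-skip s rd t)))
stepsBelow-greedyNext< (less s e) fu i j rs rd rs>0 =
  stepsBelow-sourceUsedUp< fu i j rs (suc e ∷ rd) {suc (s + e)} {rd} {s} rs>0
                           λ t _ → ℕP.≤-reflexive (sym (πL≡ t))
  where
  πL≡ : ∀ t → πL (suc (s + e) ∷ rd) (s + t) ≡ πL (suc e ∷ rd) t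
  πL≡ t = trans (cong (λ z → πL (z ∷ rd) (s + t)) (sym (ℕP.+-suc s e)))
                (πL-shift s (suc e) rd t)
stepsBelow-greedyNext< (greater d e) fu i j rs rd rs>0 k = begin-strict
  stepsBelow (i + suc k) (greedySteps fu i (suc j) (suc e ∷ rs) rd)
    ≤⟨ stepsBelow-greedySteps≤ fu i (suc j) (suc e ∷ rs) rd (s≤s z≤n ∷ rs>0) k ⟩
  πL rd (suc (e + T)) + k
    <⟨ ℕP.n<1+n _ ⟩
  suc (πL rd (suc (e + T))) + k
    ≡⟨ cong (_+ k) (sym (πL-skip d rd (e + T))) ⟩
  πL (d ∷ rd) (d + suc (e + T)) + k
    ≡⟨ cong (λ z → πL (d ∷ rd) z + k)
            (trans (ℕP.+-suc d (e + T)) (cong suc (sym (ℕP.+-assoc d e T)))) ⟩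
  πL (d ∷ rd) (suc (d + e) + T) + k ∎
  where
  open ℕP.≤-Reasoning
  T = sum (take k rs)

stepsBelow-sourceUsedUp< fu i j rs rd {d} {ds} {s} _ _ zero =
  subst (_< πL (d ∷ ds) (s + 0) + 0)
        (sym (stepsBelow-greedySteps≡0 fu (suc i) j rs rd (ℕP.≤-reflexive (ℕP.+-comm i 1))))
        (1≤πL+ d ds (s + 0) 0)
stepsBelow-sourceUsedUp< fu i j [] rd {d} {ds} {s} _ _ (suc k) =
  subst (λ ss → stepsBelow (i + suc (suc k)) ss < πL (d ∷ ds) (s + 0) + suc k)
        (sym (greedySteps-[] fu (suc i) j rd))
        (1≤πL+ d ds (s + 0) (suc k))
stepsBelow-sourceUsedUp< fu i j (r ∷ rs) rd {d} {ds} {s} (r>0 ∷ rs>0) πL≤ (suc k) = begin-strict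
  stepsBelow (i + suc (suc k)) (greedySteps fu (suc i) j (r ∷ rs) rd)
    ≡⟨ cong (λ K → stepsBelow K (greedySteps fu (suc i) j (r ∷ rs) rd))
            (ℕP.+-suc i (suc k)) ⟩
  stepsBelow (suc i + suc k) (greedySteps fu (suc i) j (r ∷ rs) rd)
    ≤⟨ stepsBelow-greedySteps≤ fu (suc i) j (r ∷ rs) rd (r>0 ∷ rs>0) k ⟩
  πL rd X + k
    ≤⟨ ℕP.+-monoˡ-≤ k (πL≤ X (ℕP.≤-trans r>0 (ℕP.m≤m+n r _))) ⟩
  πL (d ∷ ds) (s + X) + k
    <⟨ ℕP.+-monoʳ-< (πL (d ∷ ds) (s + X)) (ℕP.n<1+n k) ⟩
  πL (d ∷ ds) (s + X) + suc k ∎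
  where
  open ℕP.≤-Reasoning
  X = r + sum (take k rs)

visits : ℕ → ℕ → Step → ℕ
visits i j (i′ , j′ , _) = indicator ((i ≡ᵇ i′) ∧ (j ≡ᵇ j′))

indicator-positive-sum≤ : ∀ {A : Set} (g h : A → ℕ) xs → (∀ x → indicator (0 <ᵇ g x) ≤ h x) →
  indicator (0 <ᵇ sum (map g xs)) ≤ sum (map h xs)
indicator-positive-sum≤ g h []       _     = z≤n
indicator-positive-sum≤ g h (x ∷ xs) g≤h with g x | g≤h x
... | zero  | _   = ℕP.≤-trans (indicator-positive-sum≤ g h xs g≤h) (ℕP.m≤n+m _ (h x))
... | suc _ | 1≤h = ℕP.≤-trans 1≤h (ℕP.m≤m+n (h x) _)

indicator-positive-if≤ : ∀ c v → indicator (0 <ᵇ (if c then v else 0)) ≤ indicator c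
indicator-positive-if≤ true  zero    = z≤n
indicator-positive-if≤ true  (suc v) = s≤s z≤n
indicator-positive-if≤ false v       = z≤n

Σℕ-if-toℕ≡ᵇ≤ : ∀ {n} (g : ℕ → ℕ) c → Σℕ {n} (λ i → if toℕ i ≡ᵇ c then g (toℕ i) else 0) ≤ g c
Σℕ-if-toℕ≡ᵇ≤ {zero}  g c       = z≤n
Σℕ-if-toℕ≡ᵇ≤ {suc n} g zero    =
  ℕP.≤-reflexive (trans (cong (g 0 +_) (Σℕ-zero n)) (ℕP.+-identityʳ (g 0)))
Σℕ-if-toℕ≡ᵇ≤ {suc n} g (suc c) = Σℕ-if-toℕ≡ᵇ≤ {n} (g ∘ suc) c

prefixSum-visits-step≤ : ∀ {n m} K x y v →
  prefixSum {n} K (λ i → Σℕ {m} (λ j → visits (toℕ i) (toℕ j) (x , y , v))) ≤ indicator (x <ᵇ K)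
prefixSum-visits-step≤ {n} {m} K x y _ = begin
  prefixSum {n} K (λ i → Σℕ {m} (λ j → indicator ((toℕ i ≡ᵇ x) ∧ (toℕ j ≡ᵇ y))))
    ≤⟨ Σℕ-mono-≤ {n} (λ i → swap (toℕ i <ᵇ K) (toℕ i ≡ᵇ x)) ⟩
  Σℕ {n} (λ i → if toℕ i ≡ᵇ x then indicator (toℕ i <ᵇ K) else 0)
    ≤⟨ Σℕ-if-toℕ≡ᵇ≤ {n} (λ i → indicator (i <ᵇ K)) x ⟩
  indicator (x <ᵇ K) ∎
  where
  open ℕP.≤-Reasoning
  swap : ∀ c e →
    (if c then Σℕ {m} (λ j → indicator (e ∧ (toℕ j ≡ᵇ y))) else 0) ≤ (if e then indicator c else 0)
  swap true  true  = Σℕ-if-toℕ≡ᵇ≤ {m} (λ _ → 1) y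
  swap true  false = ℕP.≤-reflexive (Σℕ-zero m)
  swap false _     = z≤n

prefixSum-visits≤stepsBelow : ∀ {n m} K (ss : List Step) →
  prefixSum {n} K (λ i → Σℕ {m} (λ j → sum (map (visits (toℕ i) (toℕ j)) ss))) ≤ stepsBelow K ss
prefixSum-visits≤stepsBelow {n} {m} K [] =
  ℕP.≤-trans (sumOver≤Σℕ {n} (λ i → toℕ i <ᵇ K) (λ _ → Σℕ {m} (λ _ → 0)))
             (ℕP.≤-reflexive (trans (Σℕ-cong {n} (λ _ → Σℕ-zero m)) (Σℕ-zero n)))
prefixSum-visits≤stepsBelow {n} {m} K ((x , y , v) ∷ ss) = begin
  prefixSum K (λ i → Σℕ (λ j → V i j (x , y , v) + S i j))
    ≡⟨ sumOver-cong _ (λ i → Σℕ-distrib-+ (λ j → V i j (x , y , v)) (S i)) ⟩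
  prefixSum K (λ i → Σℕ (λ j → V i j (x , y , v)) + Σℕ (S i))
    ≡⟨ sumOver-distrib-+ _ (λ i → Σℕ (λ j → V i j (x , y , v))) (λ i → Σℕ (S i)) ⟩
  prefixSum K (λ i → Σℕ (λ j → V i j (x , y , v))) + prefixSum K (λ i → Σℕ (S i))
    ≤⟨ ℕP.+-mono-≤ (prefixSum-visits-step≤ {n} {m} K x y v)
                   (prefixSum-visits≤stepsBelow {n} {m} K ss) ⟩
  indicator (x <ᵇ K) + stepsBelow K ss ∎
  where
  open ℕP.≤-Reasoning
  V : Fin n → Fin m → Step → ℕ
  V i j = visits (toℕ i) (toℕ j)
  S : Fin n → Fin m → ℕ
  S i j = sum (map (V i j) ss)

degreeℕ-greedy≤visits : ∀ {n m} (a : Fin n → ℕ) (b : Fin m → ℕ) i →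
  degreeℕ (greedy a b) i
    ≤ Σℕ {m} (λ j → sum (map (visits (toℕ i) (toℕ j)) (greedySteps (n + m) 0 0 (toList a) (toList b))))
degreeℕ-greedy≤visits {n} {m} a b i = Σℕ-mono-≤ {m} λ j →
  indicator-positive-sum≤ _ (visits (toℕ i) (toℕ j)) (greedySteps (n + m) 0 0 (toList a) (toList b))
                          λ where (_ , _ , v) → indicator-positive-if≤ _ v

prefixDegree-greedy≤ : ∀ {n m} (a : Fin n → ℕ) (b : Fin m → ℕ) → (∀ i → 0 < a i) → ∀ k →
  prefixSum (suc k) (degreeℕ (greedy a b)) ≤ π b (prefixSum (suc k) a) + k
prefixDegree-greedy≤ {n} {m} a b a>0 k = begin
  prefixSum (suc k) (degreeℕ (greedy a b))
    ≤⟨ sumOver-mono-≤ {n} _ (degreeℕ-greedy≤visits a b) ⟩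
  prefixSum {n} (suc k) (λ i → Σℕ {m} (λ j → sum (map (visits (toℕ i) (toℕ j)) steps)))
    ≤⟨ prefixSum-visits≤stepsBelow {n} {m} (suc k) steps ⟩
  stepsBelow (suc k) steps
    ≤⟨ stepsBelow-greedySteps≤ (n + m) 0 0 (toList a) (toList b) (tabulate⁺ a>0) k ⟩
  π b (sum (take (suc k) (toList a))) + k
    ≡⟨ cong (λ t → π b t + k) (prefixSum≡sum∘take (suc k) a) ⟨
  π b (prefixSum (suc k) a) + k ∎
  where
  open ℕP.≤-Reasoning
  steps = greedySteps (n + m) 0 0 (toList a) (toList b)

surcharge : ∀ {n} → ℕ → Fin (suc n) → ℕ
surcharge Δ zero    = Δ
surcharge Δ (suc _) = 1

prefixSum-surcharge : ∀ {n} Δ k → k ≤ n → prefixSum {suc n} (suc k) (surcharge Δ) ≡ Δ + k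
prefixSum-surcharge {n} Δ k k≤n = cong (Δ +_) (prefixSum-const-1 {n} k k≤n)

weightedSum-surcharge : ∀ {n} (f : Fin (suc n) → ℚ) Δ →
  weightedSum f (surcharge Δ) ≡ ℕ→ℚ Δ Q.* f zero Q.+ Σℚ (λ i → f (suc i))
weightedSum-surcharge f Δ =
  cong₂ Q._+_ (QP.*-comm (f zero) (ℕ→ℚ Δ)) (Σℚ-cong (λ i → QP.*-identityʳ (f (suc i))))

degree-greedy-prefixDominated : ∀ {n m m′} {a : Fin (suc n) → ℕ} {b : Fin m → ℕ} (b′ : Fin m′ → ℕ)
  {x : Fin (suc n) → Fin m → ℚ} Δ →
  (∀ i → 0 < a i) → NonincreasingN b → IsSolution a b x →
  (∀ t → 1 ≤ t → t ≤ Σℕ a → π b′ t ≤ π b t + Δ) →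
  PrefixDominated 0 (degreeℕ (greedy a b′)) (λ i → degreeℚ x i + surcharge Δ i)
degree-greedy-prefixDominated b′ Δ a>0 b↓ x-solves π′≤π+Δ zero _ = ℕP.≤-refl
degree-greedy-prefixDominated {n} {a = a} {b} b′ {x} Δ a>0 b↓ x-solves π′≤π+Δ (suc k) (s≤s k≤n) = begin
  prefixSum (suc k) (degreeℕ (greedy a b′))
    ≤⟨ prefixDegree-greedy≤ a b′ a>0 k ⟩
  π b′ A + k
    ≤⟨ ℕP.+-monoˡ-≤ k (π′≤π+Δ A 1≤A (sumOver≤Σℕ firstK a)) ⟩
  π b A + Δ + k
    ≤⟨ ℕP.+-monoˡ-≤ k (ℕP.+-monoˡ-≤ Δ (π-prefixSupply≤prefixDegree {a = a} (suc k) x-solves b↓ 1≤A)) ⟩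
  prefixSum (suc k) (degreeℚ x) + Δ + k
    ≡⟨ ℕP.+-assoc _ Δ k ⟩
  prefixSum (suc k) (degreeℚ x) + (Δ + k)
    ≡⟨ cong (prefixSum (suc k) (degreeℚ x) +_) (prefixSum-surcharge {n} Δ k k≤n) ⟨
  prefixSum (suc k) (degreeℚ x) + prefixSum (suc k) (surcharge {n} Δ)
    ≡⟨ sumOver-distrib-+ firstK (degreeℚ x) (surcharge Δ) ⟨
  prefixSum (suc k) (λ i → degreeℚ x i + surcharge Δ i) ∎
  where
  open ℕP.≤-Reasoning
  firstK : Fin (suc n) → Bool
  firstK i = toℕ i <ᵇ suc k
  A = prefixSum (suc k) a
  1≤A : 1 ≤ A
  1≤A = ℕP.≤-trans (a>0 zero) (ℕP.m≤m+n (a zero) _)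

corollary4p4 :
    (n m m' : ℕ) (a : Fin (suc n) → ℕ) (f : Fin (suc n) → ℚ)
    (b : Fin m → ℕ) (b' : Fin m' → ℕ) (Δ : ℕ) →
    (∀ i → 0 < a i) → (∀ i → 0ℚ Q.≤ f i) →
    NonincreasingQ f →
    (∀ j → 0 < b j) → (∀ j → 0 < b' j) →
    NonincreasingN b → NonincreasingN b' →
    Σℕ a ≡ Σℕ b → Σℕ a ≡ Σℕ b' →
    (∀ t → 1 ≤ t → t ≤ Σℕ a → π b' t ≤ π b t + Δ) →
    (x : Fin (suc n) → Fin m → ℚ) → IsSolution a b x →
    costℕ f (greedy a b') Q.≤
      (costℚ f x Q.+ ℕ→ℚ Δ Q.* f zero) Q.+ Σℚ (λ i → f (suc i))
corollary4p4 n m m' a f b b' Δ a>0 f≥0 f↓ _ _ b↓ _ _ _ π′≤π+Δ x x-solves = begin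
  costℕ f (greedy a b')
    ≡⟨ costℕ≡weightedSum-degree f (greedy a b') ⟩
  weightedSum f greedyDegree
    ≤⟨ weightedSum-mono-prefix greedyDegree bound f≥0 f↓
         (degree-greedy-prefixDominated b' Δ a>0 b↓ x-solves π′≤π+Δ) ⟩
  weightedSum f bound
    ≡⟨ weightedSum-distrib-+ f (degreeℚ x) (surcharge Δ) ⟩
  weightedSum f (degreeℚ x) Q.+ weightedSum f (surcharge Δ)
    ≡⟨ cong₂ Q._+_ (sym (costℚ≡weightedSum-degree f x)) (weightedSum-surcharge f Δ) ⟩
  costℚ f x Q.+ (ℕ→ℚ Δ Q.* f zero Q.+ Σℚ (λ i → f (suc i)))
    ≡⟨ QP.+-assoc (costℚ f x) (ℕ→ℚ Δ Q.* f zero) _ ⟨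
  costℚ f x Q.+ ℕ→ℚ Δ Q.* f zero Q.+ Σℚ (λ i → f (suc i)) ∎
  where
  open QP.≤-Reasoning
  greedyDegree bound : Fin (suc n) → ℕ
  greedyDegree = degreeℕ (greedy a b')
  bound i      = degreeℚ x i + surcharge Δ i
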